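{- Let $M\in\mathcal{M}$, let $e$ be an edge of $M$ (joining a black vertex to an inner vertex) that is not a bridge, and let $M_e\in\mathcal{M}$ be obtained by unhooking $e$. Then $F(M_e)-F(M)=3-2|\mathcal{I}_2(e)|$.
   Context: The set $\mathcal{M}$: an element $M\in\mathcal{M}$ is a connected graph made of (i) square-vertices: cycles of length four whose edges ("inner edges") are colored alternately $1,2,1,2$ and whose vertices are called inner vertices; (ii) black vertices of arbitrary finite degree, each equipped with a cyclic ordering of its incident edges; (iii) edges (distinct from inner edges), each joining a black vertex to an inner vertex, such that every inner vertex is incident to exactly one such edge. For $c\in\{1,2\}$, $M^{(c)}$ is the combinatorial map obtained from $M$ by deleting all inner edges of the color other than $c$, then erasing each (now bivalent) inner vertex and merging its edge with its inner edge; its vertices are the black vertices with the induced cyclic orders. Faces of $M^{(c)}$ are the usual faces of a map (an isolated vertex has one face). $F(M)$ is the number of faces of $M^{(1)}$ plus that of $M^{(2)}$ plus the number of black vertices. An edge is a bridge if deleting it disconnects $M$. Unhooking an edge $e$ incident to the black vertex $\bar v$: remove $e$ from $\bar v$ (and from its cyclic order) and attach that end of $e$ to a new black vertex of degree one. $\mathcal{I}_2(e)\subset\{1,2\}$ is the set of colors $c$ such that, in $M^{(c)}$, the edge of $M^{(c)}$ containing $e$ is incident to two distinct faces (rather than one face on both sides). -}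

module Defs where

open import Data.Nat using (ℕ; zero; suc; _+_; _*_; _≤ᵇ_)
open import Data.Fin using (Fin; zero; suc; toℕ; fromℕ; inject₁)
open import Data.Fin.Properties using () renaming (_≟_ to _≟F_)
open import Data.Product using (Σ; ∃; _×_; _,_; proj₁; proj₂)
open import Data.Product.Properties using (≡-dec)
open import Data.Sum using (_⊎_; inj₁; inj₂)
open import Data.Bool using (Bool; true; false; not; if_then_else_)
open import Data.List using (List; length; filterᵇ; cartesianProduct; allFin; upTo)
open import Data.Bool.ListAction using (all; any)
open import Data.Empty using (⊥)
open import Relation.Nullary using (¬_; Dec; yes; no; does)
open import Relation.Binary.PropositionalEquality using (_≡_)
open import Relation.Binary.Construct.Closure.Symmetric using (SymClosure)
open import Relation.Binary.Construct.Closure.ReflexiveTransitive using (Star)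

-- * There are  s  square-vertices, indexed by  Fin s.  The inner vertices
--   of square  q  are  (q , i)  for  i : Fin 4, and the inner edges of
--   square q are  (q,i)–(q,i+1 mod 4), coloured 1 for i ∈ {0,2} and
--   2 for i ∈ {1,3}  (so the colours alternate 1,2,1,2 around the square).
-- * Every inner vertex carries exactly one (non-inner) edge, so edges are
--   identified with inner vertices:  Dart s = Fin s × Fin 4.
-- * There are  b  black vertices, indexed by Fin b;  blk d  is the black
--   endpoint of edge d.
-- * The cyclic orders at black vertices are encoded by a permutation σ of
--   the edges preserving blk and acting as a single cycle on every fibre
--   of blk (the cyclic successor of d around blk d is σ d).

Dart : ℕ → Set
Dart s = Fin s × Fin 4

_≟D_ : ∀ {s} (x y : Dart s) → Dec (x ≡ y)
_≟D_ = ≡-dec _≟F_ _≟F_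

_==D_ : ∀ {s} → Dart s → Dart s → Bool
x ==D y = does (x ≟D y)

_==F_ : ∀ {n} → Fin n → Fin n → Bool
x ==F y = does (x ≟F y)

record Raw : Set where
  field
    s   : ℕ
    b   : ℕ
    blk : Dart s → Fin b
    σ   : Dart s → Dart s
open Raw public

iter : ∀ {A : Set} → (A → A) → ℕ → A → A
iter f zero    x = x
iter f (suc k) x = f (iter f k x)

next4 : Fin 4 → Fin 4
next4 zero = suc zero
next4 (suc zero) = suc (suc zero)
next4 (suc (suc zero)) = suc (suc (suc zero))
next4 (suc (suc (suc zero))) = zero

-- Underlying graph of M: vertices are black vertices (inj₁) and inner
-- vertices (inj₂).  `Excl` is a set of (non-inner) edges that are deleted
-- (used to define bridges).
Vert : Raw → Set
Vert M = Fin (b M) ⊎ Dart (s M)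

data Adj (M : Raw) (Excl : Dart (s M) → Set) : Vert M → Vert M → Set where
  edge  : (d : Dart (s M)) → ¬ Excl d → Adj M Excl (inj₁ (blk M d)) (inj₂ d)
  inner : (q : Fin (s M)) (i : Fin 4) → Adj M Excl (inj₂ (q , i)) (inj₂ (q , next4 i))

ConnectedWithout : (M : Raw) → (Dart (s M) → Set) → Set
ConnectedWithout M Excl = (x y : Vert M) → Star (SymClosure (Adj M Excl)) x y

Connected : Raw → Set
Connected M = ConnectedWithout M (λ _ → ⊥)

IsBridge : (M : Raw) → Dart (s M) → Set
IsBridge M e = ¬ ConnectedWithout M (λ d → d ≡ e)

record InM (M : Raw) : Set where
  field
    σ⁻¹     : Dart (s M) → Dart (s M)
    σ⁻¹∘σ   : ∀ d → σ⁻¹ (σ M d) ≡ d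
    σ∘σ⁻¹   : ∀ d → σ M (σ⁻¹ d) ≡ d
    σ-blk   : ∀ d → blk M (σ M d) ≡ blk M d
    σ-cycle : ∀ d d' → blk M d ≡ blk M d' → ∃ λ k → iter (σ M) k d ≡ d'
    conn    : Connected M

-- The maps M^(1), M^(2): darts are the edges of M, vertex permutation σ,
-- and edge involution α c pairing the two ends of an inner edge of colour c.

data Colour : Set where
  c1 c2 : Colour

α : ∀ {s} → Colour → Dart s → Dart s
α c1 (q , zero)                   = (q , suc zero)
α c1 (q , suc zero)               = (q , zero)
α c1 (q , suc (suc zero))         = (q , suc (suc (suc zero)))
α c1 (q , suc (suc (suc zero)))   = (q , suc (suc zero))
α c2 (q , zero)                   = (q , suc (suc (suc zero)))
α c2 (q , suc zero)               = (q , suc (suc zero))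
α c2 (q , suc (suc zero))         = (q , suc zero)
α c2 (q , suc (suc (suc zero)))   = (q , zero)

φ : (M : Raw) → Colour → Dart (s M) → Dart (s M)
φ M c d = σ M (α c d)

darts : (s : ℕ) → List (Dart s)
darts s = cartesianProduct (allFin s) (allFin 4)

code : ∀ {s} → Dart s → ℕ
code (q , i) = 4 * toℕ q + toℕ i

ndarts : ℕ → ℕ
ndarts s = 4 * s

-- x and y lie in the same orbit of the permutation f of Dart s
-- (an orbit of a permutation of a set of size N is reached within N steps)
sameOrbit : ∀ {s} → (Dart s → Dart s) → Dart s → Dart s → Bool
sameOrbit {s} f x y = any (λ k → iter f k x ==D y) (upTo (ndarts s))

isOrbitMin : ∀ {s} → (Dart s → Dart s) → Dart s → Bool
isOrbitMin {s} f x = all (λ k → code x ≤ᵇ code (iter f k x)) (upTo (ndarts s))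

numOrbits : ∀ {s} → (Dart s → Dart s) → ℕ
numOrbits {s} f = length (filterᵇ (isOrbitMin f) (darts s))

-- black vertices of degree 0 (each is an isolated vertex, with one face)
numIsolated : Raw → ℕ
numIsolated M =
  length (filterᵇ (λ v → not (any (λ d → blk M d ==F v) (darts (s M)))) (allFin (b M)))

faces : Raw → Colour → ℕ
faces M c = numOrbits (φ M c) + numIsolated M

F : Raw → ℕ
F M = faces M c1 + faces M c2 + b M

-- Unhooking e: e is detached from blk e and attached to a new black vertex
-- (index  b , i.e. fromℕ b) of degree one; σ skips e.

unhook : (M : Raw) → Dart (s M) → Raw
unhook M e = record
  { s   = s M
  ; b   = suc (b M)
  ; blk = λ d → if d ==D e then fromℕ (b M) else inject₁ (blk M d)
  ; σ   = λ d → if d ==D e then e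
                else (if σ M d ==D e then σ M e else σ M d)
  }

-- c ∈ 𝓘₂(e): in M^(c) the edge containing e (darts e and α c e)
-- borders two distinct faces
inI₂ : (M : Raw) → Dart (s M) → Colour → Bool
inI₂ M e c = not (sameOrbit (φ M c) e (α c e))

cardI₂ : (M : Raw) → Dart (s M) → ℕ
cardI₂ M e = length (filterᵇ (inI₂ M e) (c1 Data.List.∷ c2 Data.List.∷ Data.List.[]))

module Submission where

-- Unhooking e replaces the
-- rotation σ by σ ∘ (e p), where p = σ⁻¹ e is the edge preceding e at its
-- black vertex; hence every face permutation φ_c = σ ∘ α_c becomes
-- φ_c ∘ (α_c e  α_c p).  The theorem rests on the classical fact that
-- composing a permutation with a transposition (a b) splits the orbit
-- through a and b in two when a and b share an orbit, and merges their two
-- orbits otherwise.  Since φ_c (α_c p) = e, the darts α_c e and α_c p share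
-- a φ_c-orbit exactly when e and α_c e do, i.e. when c ∉ 𝓘₂(e).  So each
-- colour c contributes +1 face if c ∉ 𝓘₂(e) and −1 face if c ∈ 𝓘₂(e), and
-- the new black vertex contributes +1.  Connectivity and the non-bridge
-- hypothesis (e is not alone at its black vertex) ensure that neither M
-- nor its unhooking has isolated vertices.

open import Defs
open import Data.Nat using (ℕ; zero; suc; _+_; _*_; _∸_; _≤_; _<_; z≤n; s≤s; _≤ᵇ_)
open import Data.Nat.Properties
open import Data.Nat.DivMod using (_%_; _/_; m≡m%n+[m/n]*n; m%n<n)
open import Data.Nat.Tactic.RingSolver using (solve-∀)
open import Data.Integer using (+_; _-_; _⊖_)
import Data.Integer.Properties as ℤ
open import Data.Fin using (Fin; zero; suc; toℕ; fromℕ; inject₁; combine)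
open import Data.Fin.Properties using (toℕ-injective; toℕ-combine; combine-injective; pigeonhole; toℕ<n)
  renaming (_≟_ to _≟F_)
open import Data.Product using (∃; _×_; _,_)
open import Data.Sum using (_⊎_; inj₁; inj₂; swap)
open import Data.Bool using (Bool; true; false; not; if_then_else_; T; T?)
open import Data.Bool.ListAction using (and; any)
open import Data.Unit using (tt)
open import Data.List using (List; []; _∷_; length; filterᵇ; map; upTo; allFin)
open import Data.List.Extrema.Nat using (argmin; argmin-all; f[argmin]≤f[xs])
open import Data.List.Properties using (filter-none; map-cong)
open import Data.List.Membership.Propositional using (_∈_; lose)
open import Data.List.Membership.Propositional.Properties using (∈-upTo⁺; ∈-map⁺; ∈-map⁻; ∈-cartesianProduct⁺; ∈-allFin)
open import Data.List.Relation.Unary.Any using (here; there; satisfied)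
open import Data.List.Relation.Unary.Any.Properties using (any⁺; any⁻)
open import Data.List.Relation.Unary.All as All using (All; []; _∷_)
open import Data.List.Relation.Unary.All.Properties using (all⁺; all⁻)
open import Data.List.Relation.Unary.Unique.Propositional using (Unique)
open import Data.List.Relation.Unary.AllPairs using (_∷_)
import Data.List.Relation.Unary.Unique.Propositional.Properties as UniqueProps
open import Data.Empty using (⊥-elim)
open import Function using (_∘_)
open import Function.Bundles using (_⇔_; mk⇔; Equivalence)
import Function.Properties.Equivalence as ⇔
open import Function.Definitions using (Injective)
open import Relation.Nullary using (¬_; Dec; yes; no; does)
open import Relation.Nullary.Decidable using (dec-true; dec-false; map′)
open import Relation.Binary.Definitions using (tri<; tri≈; tri>)
open import Relation.Binary.PropositionalEquality
open import Relation.Binary.Construct.Closure.Symmetric using (SymClosure; fwd)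
open import Relation.Binary.Construct.Closure.ReflexiveTransitive using (Star; _◅_)

open ≡-Reasoning

dartIndex : ∀ {s} → Dart s → Fin (s * 4)
dartIndex (q , i) = combine q i

dartIndex-injective : ∀ {s} {x y : Dart s} → dartIndex x ≡ dartIndex y → x ≡ y
dartIndex-injective {x = q , i} {q′ , i′} same with combine-injective q i q′ i′ same
... | refl , refl = refl

code-injective : ∀ {s} {x y : Dart s} → code x ≡ code y → x ≡ y
code-injective {x = q , i} {q′ , i′} same = dartIndex-injective (toℕ-injective (begin
  toℕ (combine q i)   ≡⟨ toℕ-combine q i ⟩
  code (q , i)        ≡⟨ same ⟩
  code (q′ , i′)      ≡⟨ toℕ-combine q′ i′ ⟨
  toℕ (combine q′ i′) ∎))

darts-unique : ∀ s → Unique (darts s)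
darts-unique s = UniqueProps.cartesianProduct⁺ (UniqueProps.allFin⁺ s) (UniqueProps.allFin⁺ 4)

∈-darts : ∀ {s} (d : Dart s) → d ∈ darts s
∈-darts (q , i) = ∈-cartesianProduct⁺ (∈-allFin q) (∈-allFin i)

T-injective : ∀ {b b′} → T b ⇔ T b′ → b ≡ b′
T-injective {false} {false} _ = refl
T-injective {false} {true}  e = ⊥-elim (Equivalence.from e tt)
T-injective {true}  {false} e = ⊥-elim (Equivalence.to e tt)
T-injective {true}  {true}  _ = refl

T-does : ∀ {A : Set} (a? : Dec A) → T (does a?) ⇔ A
T-does (yes a) = mk⇔ (λ _ → a) (λ _ → tt)
T-does (no ¬a) = mk⇔ (λ ()) ¬a

T-not : ∀ {b} → T b → ¬ T (not b)
T-not {true} _ ()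

bit : Bool → ℕ
bit true  = 1
bit false = 0

length-filterᵇ-∷ : ∀ {A : Set} (p : A → Bool) x xs →
                   length (filterᵇ p (x ∷ xs)) ≡ bit (p x) + length (filterᵇ p xs)
length-filterᵇ-∷ p x xs with p x
... | true  = refl
... | false = refl

filterᵇ-cong : ∀ {A : Set} (p q : A → Bool) {xs} →
               All (λ x → T (p x) ⇔ T (q x)) xs → filterᵇ p xs ≡ filterᵇ q xs
filterᵇ-cong p q [] = refl
filterᵇ-cong p q {x ∷ xs} (px⇔qx ∷ rest) rewrite T-injective px⇔qx with q x
... | true  = cong (x ∷_) (filterᵇ-cong p q rest)
... | false = filterᵇ-cong p q rest

length-filterᵇ-suc : ∀ {A : Set} (p q : A → Bool) {m : A} {xs : List A} →
  Unique xs → m ∈ xs → (∀ x → x ≢ m → T (p x) ⇔ T (q x)) → T (p m) → ¬ T (q m) →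
  length (filterᵇ p xs) ≡ suc (length (filterᵇ q xs))
length-filterᵇ-suc p q {m} {_ ∷ xs} (m∉xs ∷ _) (here refl) agree pm ¬qm
  with p m | q m
... | true  | false = cong (suc ∘ length)
                        (filterᵇ-cong p q (All.map (λ m≢x → agree _ (m≢x ∘ sym)) m∉xs))
... | false | _     = ⊥-elim pm
... | true  | true  = ⊥-elim (¬qm tt)
length-filterᵇ-suc p q {m} {x ∷ xs} (x∉xs ∷ unique) (there m∈xs) agree pm ¬qm
  with p x | q x | agree x (All.lookup x∉xs m∈xs)
... | true  | true  | _ = cong suc (length-filterᵇ-suc p q unique m∈xs agree pm ¬qm)
... | false | false | _ = length-filterᵇ-suc p q unique m∈xs agree pm ¬qm
... | true  | false | e = ⊥-elim (Equivalence.to e tt)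
... | false | true  | e = ⊥-elim (Equivalence.from e tt)

least-witness : (P : ℕ → Set) → (∀ n → Dec (P n)) → ∀ {k} → P k →
                ∃ λ m → P m × (∀ j → j < m → ¬ P j)
least-witness P P? {k} pk = search 0 k (λ _ ()) (subst P (sym (+-identityʳ k)) pk)
  where
    -- look for the least witness from n on, knowing there is one at d + n
    search : ∀ n d → (∀ j → j < n → ¬ P j) → P (d + n) → ∃ λ m → P m × (∀ j → j < m → ¬ P j)
    search n d below pd with P? n
    search n d       below pd | yes pn = n , pn , below
    search n zero    below pd | no ¬pn = ⊥-elim (¬pn pd)
    search n (suc d) below pd | no ¬pn =
      search (suc n) d below′ (subst P (sym (+-suc d n)) pd)
      where
        below′ : ∀ j → j < suc n → ¬ P j
        below′ j j<1+n with m≤n⇒m<n∨m≡n (≤-pred j<1+n)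
        ... | inj₁ j<n  = below j j<n
        ... | inj₂ refl = ¬pn

iter-+ : ∀ {A : Set} (f : A → A) m n x → iter f (m + n) x ≡ iter f m (iter f n x)
iter-+ f zero    n x = refl
iter-+ f (suc m) n x = cong f (iter-+ f m n x)

iter-injective : ∀ {A : Set} (f : A → A) → Injective _≡_ _≡_ f →
                 ∀ k {x y} → iter f k x ≡ iter f k y → x ≡ y
iter-injective f f-inj zero    same = same
iter-injective f f-inj (suc k) same = iter-injective f f-inj k (f-inj same)

iter-periodic : ∀ {A : Set} (f : A → A) {p x} → iter f p x ≡ x → ∀ q → iter f (q * p) x ≡ x
iter-periodic f         returns zero    = refl
iter-periodic f {p} {x} returns (suc q) = begin
  iter f (p + q * p) x        ≡⟨ iter-+ f p (q * p) x ⟩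
  iter f p (iter f (q * p) x) ≡⟨ cong (iter f p) (iter-periodic f returns q) ⟩
  iter f p x                  ≡⟨ returns ⟩
  x                           ∎

iter-fixed : ∀ {A : Set} (f : A → A) {x} → f x ≡ x → ∀ k → iter f k x ≡ x
iter-fixed f fixed zero    = refl
iter-fixed f fixed (suc k) = trans (cong f (iter-fixed f fixed k)) fixed

module Orbits {s : ℕ} (f : Dart s → Dart s) (f-injective : Injective _≡_ _≡_ f) where

  infix 4 _↝_
  _↝_ : Dart s → Dart s → Set
  x ↝ y = ∃ λ k → iter f k x ≡ y

  -- every dart returns to itself within ndarts s steps (pigeonhole)
  period : ∀ x → ∃ λ p → 0 < p × p ≤ ndarts s × iter f p x ≡ x
  period x with pigeonhole (n<1+n (s * 4)) (λ (i : Fin (suc (s * 4))) → dartIndex (iter f (toℕ i) x))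
  ... | i , j , i<j , same = toℕ j ∸ toℕ i , m<n⇒0<n∸m i<j , bounded , returns
    where
      returns : iter f (toℕ j ∸ toℕ i) x ≡ x
      returns = iter-injective f f-injective (toℕ i) (begin
        iter f (toℕ i) (iter f (toℕ j ∸ toℕ i) x) ≡⟨ iter-+ f (toℕ i) _ x ⟨
        iter f (toℕ i + (toℕ j ∸ toℕ i)) x        ≡⟨ cong (λ n → iter f n x) (m+[n∸m]≡n (<⇒≤ i<j)) ⟩
        iter f (toℕ j) x                          ≡⟨ dartIndex-injective same ⟨
        iter f (toℕ i) x                          ∎)
      bounded : toℕ j ∸ toℕ i ≤ ndarts s
      bounded = ≤-trans (m∸n≤m (toℕ j) (toℕ i)) (subst (toℕ j ≤_) (*-comm s 4) (≤-pred (toℕ<n j)))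

  shortcut : ∀ {x y} → x ↝ y → ∃ λ k → k < ndarts s × iter f k x ≡ y
  shortcut {x} {y} (k , reach) with period x
  ... | suc p , _ , p<N , returns = k % suc p , ≤-trans (m%n<n k (suc p)) p<N , (begin
    iter f (k % suc p) x                             ≡⟨ cong (iter f (k % suc p)) (iter-periodic f returns (k / suc p)) ⟨
    iter f (k % suc p) (iter f (k / suc p * suc p) x) ≡⟨ iter-+ f (k % suc p) _ x ⟨
    iter f (k % suc p + k / suc p * suc p) x         ≡⟨ cong (λ n → iter f n x) (m≡m%n+[m/n]*n k (suc p)) ⟨
    iter f k x                                       ≡⟨ reach ⟩
    y                                                ∎)

  -- _↝_ is an equivalence relation (symmetry because f is a permutation)
  ↝-refl : ∀ x → x ↝ x
  ↝-refl x = 0 , refl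

  ↝-trans : ∀ {x y z} → x ↝ y → y ↝ z → x ↝ z
  ↝-trans {x} (m , refl) (n , refl) = n + m , iter-+ f n m x

  ↝-step : ∀ {x y} → x ↝ y → x ↝ f y
  ↝-step (k , reach) = suc k , cong f reach

  ↝-sym : ∀ {x y} → x ↝ y → y ↝ x
  ↝-sym {x} (k , refl) with period x
  ... | suc p , _ , _ , returns = p * k , (begin
    iter f (p * k) (iter f k x) ≡⟨ iter-+ f (p * k) k x ⟨
    iter f (p * k + k) x        ≡⟨ cong (λ n → iter f n x) (regroup p k) ⟩
    iter f (k * suc p) x        ≡⟨ iter-periodic f returns k ⟩
    x                           ∎)
    where
      regroup : ∀ p k → p * k + k ≡ k * suc p
      regroup = solve-∀

  sameOrbit⇔ : ∀ {x y} → T (sameOrbit f x y) ⇔ x ↝ y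
  sameOrbit⇔ {x} {y} = mk⇔ sound complete
    where
      sound : T (sameOrbit f x y) → x ↝ y
      sound t with k , hit ← satisfied (any⁻ _ (upTo (ndarts s)) t) =
        k , Equivalence.to (T-does (iter f k x ≟D y)) hit
      complete : x ↝ y → T (sameOrbit f x y)
      complete r with k , k<N , reach ← shortcut r =
        any⁺ _ (lose (∈-upTo⁺ k<N) (Equivalence.from (T-does (iter f k x ≟D y)) reach))

  _↝?_ : ∀ x y → Dec (x ↝ y)
  x ↝? y = map′ (Equivalence.to sameOrbit⇔) (Equivalence.from sameOrbit⇔) (T? (sameOrbit f x y))

  IsOrbitMin : Dart s → Set
  IsOrbitMin x = ∀ y → x ↝ y → code x ≤ code y

  isOrbitMin-sound : ∀ {x} → T (isOrbitMin f x) → IsOrbitMin x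
  isOrbitMin-sound {x} t y r with k , k<N , refl ← shortcut r =
    ≤ᵇ⇒≤ (code x) (code (iter f k x)) (All.lookup (all⁺ _ (upTo (ndarts s)) t) (∈-upTo⁺ k<N))

  isOrbitMin-complete : ∀ {x} → IsOrbitMin x → T (isOrbitMin f x)
  isOrbitMin-complete {x} least =
    all⁻ (λ k → code x ≤ᵇ code (iter f k x)) {upTo (ndarts s)}
         (All.tabulate (λ {k} _ → ≤⇒≤ᵇ (least (iter f k x) (k , refl))))

  -- every orbit has a dart of least code: the argmin of its first ndarts s points
  orbitMin : ∀ x → ∃ λ m → x ↝ m × (∀ y → x ↝ y → code m ≤ code y)
  orbitMin x = m , argmin-all code {P = x ↝_} (↝-refl x) (All.tabulate on-orbit) , least
    where
      orbit : List (Dart s)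
      orbit = map (λ k → iter f k x) (upTo (ndarts s))
      m : Dart s
      m = argmin code x orbit
      on-orbit : ∀ {y} → y ∈ orbit → x ↝ y
      on-orbit y∈ with k , _ , refl ← ∈-map⁻ (λ k → iter f k x) y∈ = k , refl
      least : ∀ y → x ↝ y → code m ≤ code y
      least y r with k , k<N , refl ← shortcut r =
        All.lookup (f[argmin]≤f[xs] {f = code} x orbit) (∈-map⁺ (λ k → iter f k x) (∈-upTo⁺ k<N))

module OrbitSplit {s : ℕ} (f g : Dart s → Dart s)
    (f-injective : Injective _≡_ _≡_ f) (g-injective : Injective _≡_ _≡_ g) where

  private
    module F = Orbits f f-injective
    module G = Orbits g g-injective

  open F using () renaming (_↝_ to _↝f_)
  open G using () renaming (_↝_ to _↝g_)

  same-orbit-outside : ∀ {a} → (∀ x → ¬ a ↝f x → g x ≡ f x) →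
                       ∀ {x} → ¬ a ↝f x → ∀ k → iter g k x ≡ iter f k x
  same-orbit-outside agree a↝̸x zero    = refl
  same-orbit-outside agree {x} a↝̸x (suc k) =
    trans (cong g (same-orbit-outside agree a↝̸x k))
          (agree _ (λ a↝fᵏx → a↝̸x (F.↝-trans a↝fᵏx (F.↝-sym (k , refl)))))

  -- the minimal-representative predicates of f and g differ only at the
  -- larger of the two g-orbit minima inside the f-orbit of a
  module Ordered (a u v : Dart s)
      (cover  : ∀ x → a ↝f x → u ↝g x ⊎ v ↝g x)
      (inside : ∀ x → u ↝g x ⊎ v ↝g x → a ↝f x)
      (agree  : ∀ x → ¬ a ↝f x → g x ≡ f x)
      {m₁ m₂ : Dart s}
      (u↝m₁ : u ↝g m₁) (m₁-least : ∀ y → u ↝g y → code m₁ ≤ code y)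
      (v↝m₂ : v ↝g m₂) (m₂-least : ∀ y → v ↝g y → code m₂ ≤ code y)
      (m₁<m₂ : code m₁ < code m₂) where

    within : ∀ {x y} → a ↝f x → a ↝f y → x ↝f y
    within a↝x a↝y = F.↝-trans (F.↝-sym a↝x) a↝y

    m₁-least-in-orbit : ∀ y → a ↝f y → code m₁ ≤ code y
    m₁-least-in-orbit y a↝y with cover y a↝y
    ... | inj₁ u↝y = m₁-least y u↝y
    ... | inj₂ v↝y = ≤-trans (<⇒≤ m₁<m₂) (m₂-least y v↝y)

    -- off m₂, being an orbit minimum means the same for f and g: off the orbit
    -- of a the orbits coincide, in the g-orbit of u both minima are m₁, and in
    -- the g-orbit of v neither map has a minimum other than m₂
    min-agree : ∀ x → x ≢ m₂ → T (isOrbitMin g x) ⇔ T (isOrbitMin f x)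
    min-agree x x≢m₂ with a F.↝? x
    ... | no a↝̸x = mk⇔ (subst T same) (subst T (sym same))
      where
        same : isOrbitMin g x ≡ isOrbitMin f x
        same = cong and (map-cong (λ k → cong (λ y → code x ≤ᵇ code y)
                                           (same-orbit-outside agree a↝̸x k))
                                  (upTo (ndarts s)))
    ... | yes a↝x with cover x a↝x
    ... | inj₁ u↝x = mk⇔
      (λ t → F.isOrbitMin-complete λ y x↝y →
        ≤-trans (G.isOrbitMin-sound t m₁ (G.↝-trans (G.↝-sym u↝x) u↝m₁))
                (m₁-least-in-orbit y (F.↝-trans a↝x x↝y)))
      (λ t → G.isOrbitMin-complete λ y x↝y →
        F.isOrbitMin-sound t y (within a↝x (inside y (inj₁ (G.↝-trans u↝x x↝y)))))
    ... | inj₂ v↝x = mk⇔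
      (λ t → ⊥-elim (x≢m₂ (code-injective (≤-antisym
        (G.isOrbitMin-sound t m₂ (G.↝-trans (G.↝-sym v↝x) v↝m₂)) (m₂-least x v↝x)))))
      (λ t → ⊥-elim (<⇒≱ m₁<m₂ (≤-trans (m₂-least x v↝x)
        (F.isOrbitMin-sound t m₁ (within a↝x (inside m₁ (inj₁ u↝m₁)))))))

    m₂-min-for-g : T (isOrbitMin g m₂)
    m₂-min-for-g = G.isOrbitMin-complete λ y m₂↝y → m₂-least y (G.↝-trans v↝m₂ m₂↝y)

    m₂-not-min-for-f : ¬ T (isOrbitMin f m₂)
    m₂-not-min-for-f t = <⇒≱ m₁<m₂
      (F.isOrbitMin-sound t m₁ (within (inside m₂ (inj₂ v↝m₂)) (inside m₁ (inj₁ u↝m₁))))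

    count : numOrbits g ≡ suc (numOrbits f)
    count = length-filterᵇ-suc (isOrbitMin g) (isOrbitMin f) (darts-unique s) (∈-darts m₂)
              min-agree m₂-min-for-g m₂-not-min-for-f

  numOrbits-split : (a b : Dart s) →
    (∀ x → a ↝f x → a ↝g x ⊎ b ↝g x) → (∀ x → a ↝g x ⊎ b ↝g x → a ↝f x) →
    ¬ a ↝g b → (∀ x → ¬ a ↝f x → g x ≡ f x) →
    numOrbits g ≡ suc (numOrbits f)
  numOrbits-split a b cover inside apart agree
    with m₁ , a↝m₁ , m₁-least ← G.orbitMin a | m₂ , b↝m₂ , m₂-least ← G.orbitMin b
    with <-cmp (code m₁) (code m₂)
  ... | tri< m₁<m₂ _ _ =
    Ordered.count a a b cover inside agree a↝m₁ m₁-least b↝m₂ m₂-least m₁<m₂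
  ... | tri> _ _ m₂<m₁ =
    Ordered.count a b a (λ x → swap ∘ cover x) (λ x → inside x ∘ swap) agree
                  b↝m₂ m₂-least a↝m₁ m₁-least m₂<m₁
  ... | tri≈ _ same _ = ⊥-elim (apart
    (G.↝-trans a↝m₁ (subst (_↝g b) (sym (code-injective same)) (G.↝-sym b↝m₂))))

transpose : ∀ {s} → Dart s → Dart s → Dart s → Dart s
transpose x y z = if z ==D x then y else (if z ==D y then x else z)

transpose-left : ∀ {s} (x y : Dart s) → transpose x y x ≡ y
transpose-left x y rewrite dec-true (x ≟D x) refl = refl

transpose-right : ∀ {s} (x y : Dart s) → transpose x y y ≡ x
transpose-right x y with y ≟D x
... | yes y≡x = y≡x
... | no  _   rewrite dec-true (y ≟D y) refl = refl

transpose-other : ∀ {s} {x y z : Dart s} → z ≢ x → z ≢ y → transpose x y z ≡ z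
transpose-other {x = x} {y} {z} z≢x z≢y
  rewrite dec-false (z ≟D x) z≢x | dec-false (z ≟D y) z≢y = refl

transpose-involutive : ∀ {s} (x y z : Dart s) → transpose x y (transpose x y z) ≡ z
transpose-involutive x y z with z ≟D x
... | yes refl = transpose-right z y
... | no  z≢x with z ≟D y
...   | yes refl = transpose-left x z
...   | no  z≢y  = transpose-other z≢x z≢y

transpose-conjugate : ∀ {s} (h : Dart s → Dart s) → Injective _≡_ _≡_ h →
                      ∀ x y z → h (transpose x y z) ≡ transpose (h x) (h y) (h z)
transpose-conjugate h h-inj x y z with z ≟D x
... | yes refl = sym (transpose-left (h z) (h y))
... | no  z≢x with z ≟D y
...   | yes refl = sym (transpose-right (h x) (h z))
...   | no  z≢y  = sym (transpose-other (z≢x ∘ h-inj) (z≢y ∘ h-inj))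

module Transposition {s : ℕ} (f : Dart s → Dart s) (f-injective : Injective _≡_ _≡_ f)
    (a b : Dart s) (a≢b : a ≢ b)
    (g : Dart s → Dart s) (g-def : ∀ z → g z ≡ f (transpose a b z)) where

  g-injective : Injective _≡_ _≡_ g
  g-injective {x} {y} gx≡gy = begin
    x                             ≡⟨ transpose-involutive a b x ⟨
    transpose a b (transpose a b x) ≡⟨ cong (transpose a b) (f-injective (begin
      f (transpose a b x) ≡⟨ g-def x ⟨
      g x                 ≡⟨ gx≡gy ⟩
      g y                 ≡⟨ g-def y ⟩
      f (transpose a b y) ∎)) ⟩
    transpose a b (transpose a b y) ≡⟨ transpose-involutive a b y ⟩
    y                             ∎

  f-def : ∀ z → f z ≡ g (transpose a b z)
  f-def z = trans (cong f (sym (transpose-involutive a b z))) (sym (g-def (transpose a b z)))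

  g-at-a : g a ≡ f b
  g-at-a = trans (g-def a) (cong f (transpose-left a b))

  g-at-b : g b ≡ f a
  g-at-b = trans (g-def b) (cong f (transpose-right a b))

  g-elsewhere : ∀ {z} → z ≢ a → z ≢ b → g z ≡ f z
  g-elsewhere z≢a z≢b = trans (g-def _) (cong f (transpose-other z≢a z≢b))

  module F = Orbits f f-injective
  module G = Orbits g g-injective

  open F using () renaming (_↝_ to _↝f_)
  open G using () renaming (_↝_ to _↝g_)

  cover : ∀ x → a ↝f x → a ↝g x ⊎ b ↝g x
  cover x (k , refl) = along k
    where
      along : ∀ k → a ↝g iter f k a ⊎ b ↝g iter f k a
      along zero = inj₁ (G.↝-refl a)
      along (suc k) with iter f k a ≟D a | iter f k a ≟D b | along k
      ... | yes fᵏa≡a | _         | _ = inj₂ (1 , trans g-at-b (cong f (sym fᵏa≡a)))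
      ... | no _      | yes fᵏa≡b | _ = inj₁ (1 , trans g-at-a (cong f (sym fᵏa≡b)))
      ... | no fᵏa≢a  | no fᵏa≢b  | inj₁ a↝ = inj₁ (subst (a ↝g_) (g-elsewhere fᵏa≢a fᵏa≢b) (G.↝-step a↝))
      ... | no fᵏa≢a  | no fᵏa≢b  | inj₂ b↝ = inj₂ (subst (b ↝g_) (g-elsewhere fᵏa≢a fᵏa≢b) (G.↝-step b↝))

  module SameOrbit (a↝b : a ↝f b) where

    -- the f-orbit of a is closed under g, so it contains the g-orbits of a and b
    g-closed : ∀ {x} → a ↝f x → a ↝f g x
    g-closed {x} a↝x with x ≟D a | x ≟D b
    ... | yes refl | _        = subst (a ↝f_) (sym g-at-a) (F.↝-step a↝b)
    ... | no _     | yes refl = subst (a ↝f_) (sym g-at-b) (F.↝-step (F.↝-refl a))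
    ... | no x≢a   | no x≢b   = subst (a ↝f_) (sym (g-elsewhere x≢a x≢b)) (F.↝-step a↝x)

    g-orbit-inside : ∀ {y x} → a ↝f y → y ↝g x → a ↝f x
    g-orbit-inside a↝y (zero  , refl) = a↝y
    g-orbit-inside a↝y (suc k , refl) = g-closed (g-orbit-inside a↝y (k , refl))

    inside : ∀ x → a ↝g x ⊎ b ↝g x → a ↝f x
    inside x (inj₁ a↝x) = g-orbit-inside (F.↝-refl a) a↝x
    inside x (inj₂ b↝x) = g-orbit-inside a↝b b↝x

    -- outside the f-orbit of a neither a nor b is moved, so g agrees with f
    agree : ∀ x → ¬ a ↝f x → g x ≡ f x
    agree x a↝̸x = g-elsewhere (λ { refl → a↝̸x (F.↝-refl a) }) (λ { refl → a↝̸x a↝b })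

    -- a and b now lie on different g-orbits: if f^(l+1) b = a with l least,
    -- the g-orbit of a is f b, f² b, …, f^(l+1) b = a, which avoids b
    apart : ¬ a ↝g b
    apart (k , gᵏa≡b) with F.↝-sym a↝b
    ... | zero  , b≡a = a≢b (sym b≡a)
    ... | suc n , fⁿ⁺¹b≡a
      with l , fˡ⁺¹b≡a , earlier ←
           least-witness (λ j → iter f (suc j) b ≡ a) (λ j → iter f (suc j) b ≟D a) {n} fⁿ⁺¹b≡a
      = let i , i≤l , fⁱ⁺¹b≡b = on-b in avoids-b i i≤l fⁱ⁺¹b≡b
      where
        Segment : Dart s → Set
        Segment y = ∃ λ i → i ≤ l × iter f (suc i) b ≡ y

        avoids-b : ∀ i → i ≤ l → iter f (suc i) b ≢ b
        avoids-b i i≤l fⁱ⁺¹b≡b with m≤n⇒m<n∨m≡n i≤l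
        ... | inj₂ refl = a≢b (trans (sym fˡ⁺¹b≡a) fⁱ⁺¹b≡b)
        ... | inj₁ i<l  = earlier (l ∸ suc i) (∸-monoʳ-< {l} {suc i} {0} (s≤s z≤n) i<l) (begin
          iter f (suc (l ∸ suc i)) b                 ≡⟨ cong (iter f (suc (l ∸ suc i))) fⁱ⁺¹b≡b ⟨
          iter f (suc (l ∸ suc i)) (iter f (suc i) b) ≡⟨ iter-+ f (suc (l ∸ suc i)) (suc i) b ⟨
          iter f (suc (l ∸ suc i + suc i)) b         ≡⟨ cong (λ n → iter f (suc n) b) (m∸n+n≡m i<l) ⟩
          iter f (suc l) b                           ≡⟨ fˡ⁺¹b≡a ⟩
          a                                          ∎)

        g-step : ∀ {y} → Segment y → Segment (g y)
        g-step (i , i≤l , refl) with m≤n⇒m<n∨m≡n i≤l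
        ... | inj₁ i<l  = suc i , i<l , sym (g-elsewhere (earlier i i<l) (avoids-b i i≤l))
        ... | inj₂ refl = 0 , z≤n , trans (sym g-at-a) (cong g (sym fˡ⁺¹b≡a))

        orbit-of-a : ∀ k → Segment (iter g k a)
        orbit-of-a zero    = l , ≤-refl , fˡ⁺¹b≡a
        orbit-of-a (suc k) = g-step (orbit-of-a k)

        on-b : Segment b
        on-b = subst Segment gᵏa≡b (orbit-of-a k)

    numOrbits-split : numOrbits g ≡ suc (numOrbits f)
    numOrbits-split =
      OrbitSplit.numOrbits-split f g f-injective g-injective a b cover inside apart agree

  -- if a and b lie on different f-orbits, g joins them: until f returns to b,
  -- the g-orbit of a follows the f-orbit of b
  merge : ¬ a ↝f b → a ↝g b
  merge a↝̸b with F.period b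
  ... | suc p , _ , _ , fᵖb≡b
    with i , fⁱ⁺¹b≡b , earlier ←
         least-witness (λ j → iter f (suc j) b ≡ b) (λ j → iter f (suc j) b ≟D b) {p} fᵖb≡b
    = suc i , trans (follows i ≤-refl) fⁱ⁺¹b≡b
    where
      follows : ∀ j → j ≤ i → iter g (suc j) a ≡ iter f (suc j) b
      follows zero    _   = g-at-a
      follows (suc j) j<i = trans (cong g (follows j (<⇒≤ j<i)))
        (g-elsewhere (λ fʲ⁺¹b≡a → a↝̸b (F.↝-sym (suc j , fʲ⁺¹b≡a))) (earlier j j<i))

-- If a and b lie on different f-orbits, g = f ∘ (a b) has one orbit fewer:
-- f = g ∘ (a b) is the split of g along its joined orbit.
numOrbits-merge : ∀ {s} (f : Dart s → Dart s) (f-injective : Injective _≡_ _≡_ f)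
  (a b : Dart s) (a≢b : a ≢ b) (g : Dart s → Dart s) (g-def : ∀ z → g z ≡ f (transpose a b z)) →
  ¬ Orbits._↝_ f f-injective a b → numOrbits f ≡ suc (numOrbits g)
numOrbits-merge f f-injective a b a≢b g g-def a↝̸b =
  Transposition.SameOrbit.numOrbits-split g g-injective a b a≢b f f-def (merge a↝̸b)
  where open Transposition f f-injective a b a≢b g g-def

α-involutive : ∀ {s} c (d : Dart s) → α c (α c d) ≡ d
α-involutive c1 (q , zero)                 = refl
α-involutive c1 (q , suc zero)             = refl
α-involutive c1 (q , suc (suc zero))       = refl
α-involutive c1 (q , suc (suc (suc zero))) = refl
α-involutive c2 (q , zero)                 = refl
α-involutive c2 (q , suc zero)             = refl
α-involutive c2 (q , suc (suc zero))       = refl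
α-involutive c2 (q , suc (suc (suc zero))) = refl

α-injective : ∀ {s} c → Injective _≡_ _≡_ (α {s} c)
α-injective c {x} {y} same =
  trans (sym (α-involutive c x)) (trans (cong (α c) same) (α-involutive c y))

first-edge : ∀ {N : Raw} {Excl : Dart (s N) → Set} {v y} →
             Star (SymClosure (Adj N Excl)) (inj₁ v) (inj₂ y) → ∃ λ d → blk N d ≡ v × ¬ Excl d
first-edge (fwd (edge d d∉Excl) ◅ _) = d , refl , d∉Excl

numIsolated-zero : (N : Raw) → (∀ v → ∃ λ d → blk N d ≡ v) → numIsolated N ≡ 0
numIsolated-zero N has-edge =
  cong length (filter-none (T? ∘ isolated) {allFin (b N)} (All.tabulate (λ {v} _ → not-isolated v)))
  where
    isolated : Fin (b N) → Bool
    isolated v = not (any (λ d → blk N d ==F v) (darts (s N)))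
    not-isolated : ∀ v → ¬ T (isolated v)
    not-isolated v with d , refl ← has-edge v =
      T-not (any⁺ _ (lose (∈-darts d) (Equivalence.from (T-does (blk N d ≟F blk N d)) refl)))

last-or-inject₁ : ∀ {n} (v : Fin (suc n)) → v ≡ fromℕ n ⊎ ∃ λ w → v ≡ inject₁ w
last-or-inject₁ {zero}  zero    = inj₁ refl
last-or-inject₁ {suc n} zero    = inj₂ (zero , refl)
last-or-inject₁ {suc n} (suc v) with last-or-inject₁ v
... | inj₁ v≡last     = inj₁ (cong suc v≡last)
... | inj₂ (w , v≡w) = inj₂ (suc w , cong suc v≡w)

module Unhooking (M : Raw) (M∈𝓜 : InM M) (e : Dart (s M)) (e-not-bridge : ¬ IsBridge M e) where
  open InM M∈𝓜

  Mₑ : Raw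
  Mₑ = unhook M e

  σ-injective : Injective _≡_ _≡_ (σ M)
  σ-injective {x} {y} same = begin
    x               ≡⟨ σ⁻¹∘σ x ⟨
    σ⁻¹ (σ M x)     ≡⟨ cong σ⁻¹ same ⟩
    σ⁻¹ (σ M y)     ≡⟨ σ⁻¹∘σ y ⟩
    y               ∎

  -- e is not alone at its black vertex, since otherwise deleting e would
  -- leave that vertex without edges, disconnecting M
  σe≢e : σ M e ≢ e
  σe≢e fixed = e-not-bridge λ connected →
    let d , blk-d , d≢e = first-edge (connected (inj₁ (blk M e)) (inj₂ e))
        k , σᵏe≡d       = σ-cycle e d (sym blk-d)
    in d≢e (trans (sym σᵏe≡d) (iter-fixed (σ M) fixed k))

  p : Dart (s M)
  p = σ⁻¹ e

  p≢e : p ≢ e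
  p≢e p≡e = σe≢e (trans (cong (σ M) (sym p≡e)) (σ∘σ⁻¹ e))

  σ-avoids-e : ∀ {d} → d ≢ p → σ M d ≢ e
  σ-avoids-e {d} d≢p σd≡e = d≢p (trans (sym (σ⁻¹∘σ d)) (cong σ⁻¹ σd≡e))

  unhook-σ : ∀ d → σ Mₑ d ≡ σ M (transpose e p d)
  unhook-σ d with d ≟D e
  ... | yes refl = sym (σ∘σ⁻¹ d)
  ... | no d≢e with d ≟D p
  ...   | yes refl rewrite σ∘σ⁻¹ e | dec-true (e ≟D e) refl = refl
  ...   | no d≢p   rewrite dec-false (σ M d ≟D e) (σ-avoids-e d≢p) = refl

  unhook-φ : ∀ c d → φ Mₑ c d ≡ φ M c (transpose (α c e) (α c p) d)
  unhook-φ c d = begin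
    σ Mₑ (α c d)
      ≡⟨ unhook-σ (α c d) ⟩
    σ M (transpose e p (α c d))
      ≡⟨ cong₂ (λ x y → σ M (transpose x y (α c d))) (α-involutive c e) (α-involutive c p) ⟨
    σ M (transpose (α c (α c e)) (α c (α c p)) (α c d))
      ≡⟨ cong (σ M) (transpose-conjugate (α c) (α-injective c) (α c e) (α c p) d) ⟨
    σ M (α c (transpose (α c e) (α c p) d))
      ∎

  edge-at : ∀ v → ∃ λ d → blk M d ≡ v
  edge-at v = let d , blk-d , _ = first-edge (conn (inj₁ v) (inj₂ e)) in d , blk-d

  no-isolated-M : numIsolated M ≡ 0
  no-isolated-M = numIsolated-zero M edge-at

  no-isolated-Mₑ : numIsolated Mₑ ≡ 0
  no-isolated-Mₑ = numIsolated-zero Mₑ has-edge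
    where
      blk-new : blk Mₑ e ≡ fromℕ (b M)
      blk-new rewrite dec-true (e ≟D e) refl = refl

      blk-old : ∀ {d} → d ≢ e → blk Mₑ d ≡ inject₁ (blk M d)
      blk-old {d} d≢e rewrite dec-false (d ≟D e) d≢e = refl

      -- the new vertex carries e; an old vertex keeps its edges other than e,
      -- and one exists since e is not alone at its vertex
      has-edge : ∀ v → ∃ λ d → blk Mₑ d ≡ v
      has-edge v with last-or-inject₁ v
      ... | inj₁ refl = e , blk-new
      ... | inj₂ (w , refl) with edge-at w
      ...   | d , refl with d ≟D e
      ...     | no d≢e   = d , blk-old d≢e
      ...     | yes refl = σ M e , trans (blk-old σe≢e) (cong inject₁ (σ-blk e))

  module AtColour (c : Colour) where
    f-injective : Injective _≡_ _≡_ (φ M c)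
    f-injective = α-injective c ∘ σ-injective

    open Orbits (φ M c) f-injective

    a≢b : α c e ≢ α c p
    a≢b = p≢e ∘ sym ∘ α-injective c

    b↝e : α c p ↝ e
    b↝e = 1 , trans (cong (σ M) (α-involutive c p)) (σ∘σ⁻¹ e)

    -- so α e and α p share a face exactly when e and α e do, i.e. when c ∉ 𝓘₂(e)
    same-face⇔ : T (sameOrbit (φ M c) e (α c e)) ⇔ α c e ↝ α c p
    same-face⇔ = ⇔.trans sameOrbit⇔
      (mk⇔ (λ e↝a → ↝-sym (↝-trans b↝e e↝a)) (λ a↝b → ↝-sym (↝-trans a↝b b↝e)))

    orbit-change : numOrbits (φ Mₑ c) + 2 * bit (inI₂ M e c) ≡ suc (numOrbits (φ M c))
    orbit-change with sameOrbit (φ M c) e (α c e) in same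
    ... | true  = trans (+-identityʳ _)
      (Transposition.SameOrbit.numOrbits-split (φ M c) f-injective (α c e) (α c p) a≢b
        (φ Mₑ c) (unhook-φ c) (Equivalence.to same-face⇔ (subst T (sym same) tt)))
    ... | false = trans (+-comm _ 2) (cong suc (sym
      (numOrbits-merge (φ M c) f-injective (α c e) (α c p) a≢b (φ Mₑ c) (unhook-φ c)
        (subst T same ∘ Equivalence.from same-face⇔))))

  face-change : ∀ c → faces Mₑ c + 2 * bit (inI₂ M e c) ≡ suc (faces M c)
  face-change c = begin
    numOrbits (φ Mₑ c) + numIsolated Mₑ + 2 * bit (inI₂ M e c)
      ≡⟨ cong (λ n → numOrbits (φ Mₑ c) + n + 2 * bit (inI₂ M e c)) no-isolated-Mₑ ⟩
    numOrbits (φ Mₑ c) + 0 + 2 * bit (inI₂ M e c)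
      ≡⟨ cong (λ n → n + 2 * bit (inI₂ M e c)) (+-identityʳ (numOrbits (φ Mₑ c))) ⟩
    numOrbits (φ Mₑ c) + 2 * bit (inI₂ M e c)
      ≡⟨ AtColour.orbit-change c ⟩
    suc (numOrbits (φ M c))
      ≡⟨ cong suc (+-identityʳ (numOrbits (φ M c))) ⟨
    suc (numOrbits (φ M c) + 0)
      ≡⟨ cong (λ n → suc (numOrbits (φ M c) + n)) no-isolated-M ⟨
    suc (numOrbits (φ M c) + numIsolated M)
      ∎

cardI₂-bits : (M : Raw) (e : Dart (s M)) → cardI₂ M e ≡ bit (inI₂ M e c1) + bit (inI₂ M e c2)
cardI₂-bits M e = begin
  cardI₂ M e
    ≡⟨ length-filterᵇ-∷ (inI₂ M e) c1 (c2 ∷ []) ⟩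
  bit (inI₂ M e c1) + length (filterᵇ (inI₂ M e) (c2 ∷ []))
    ≡⟨ cong (λ n → bit (inI₂ M e c1) + n) (length-filterᵇ-∷ (inI₂ M e) c2 []) ⟩
  bit (inI₂ M e c1) + (bit (inI₂ M e c2) + 0)
    ≡⟨ cong (λ n → bit (inI₂ M e c1) + n) (+-identityʳ (bit (inI₂ M e c2))) ⟩
  bit (inI₂ M e c1) + bit (inI₂ M e c2)
    ∎

faces-arith : ∀ g₁ g₂ f₁ f₂ i₁ i₂ B → g₁ + 2 * i₁ ≡ suc f₁ → g₂ + 2 * i₂ ≡ suc f₂ →
              g₁ + g₂ + suc B + 2 * (i₁ + i₂) ≡ f₁ + f₂ + B + 3
faces-arith g₁ g₂ f₁ f₂ i₁ i₂ B change₁ change₂ = begin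
  g₁ + g₂ + suc B + 2 * (i₁ + i₂)       ≡⟨ regroup g₁ g₂ i₁ i₂ B ⟩
  (g₁ + 2 * i₁) + (g₂ + 2 * i₂) + suc B ≡⟨ cong₂ (λ x y → x + y + suc B) change₁ change₂ ⟩
  suc f₁ + suc f₂ + suc B               ≡⟨ collect f₁ f₂ B ⟩
  f₁ + f₂ + B + 3                       ∎
  where
    regroup : ∀ g₁ g₂ i₁ i₂ B →
              g₁ + g₂ + suc B + 2 * (i₁ + i₂) ≡ (g₁ + 2 * i₁) + (g₂ + 2 * i₂) + suc B
    regroup = solve-∀
    collect : ∀ f₁ f₂ B → suc f₁ + suc f₂ + suc B ≡ f₁ + f₂ + B + 3
    collect = solve-∀

ℤ-difference : ∀ x y k l → x + l ≡ y + k → + x - + y ≡ + k - + l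
ℤ-difference x y k l eq = begin
  + x - + y           ≡⟨ ℤ.[+m]-[+n]≡m⊖n x y ⟩
  x ⊖ y               ≡⟨ ℤ.+-cancelˡ-⊖ l x y ⟨
  (l + x) ⊖ (l + y)   ≡⟨ cong₂ _⊖_ (trans (+-comm l x) eq) (+-comm l y) ⟩
  (y + k) ⊖ (y + l)   ≡⟨ ℤ.+-cancelˡ-⊖ y k l ⟩
  k ⊖ l               ≡⟨ ℤ.[+m]-[+n]≡m⊖n k l ⟨
  + k - + l           ∎

lemma1 : (M : Raw) → InM M → (e : Dart (s M)) → ¬ IsBridge M e →
         (+ F (unhook M e)) - (+ F M) ≡ + 3 - + (2 * cardI₂ M e)
lemma1 M M∈𝓜 e e-not-bridge = ℤ-difference (F Mₑ) (F M) 3 (2 * cardI₂ M e) (begin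
  F Mₑ + 2 * cardI₂ M e
    ≡⟨ cong (λ n → F Mₑ + 2 * n) (cardI₂-bits M e) ⟩
  F Mₑ + 2 * (bit (inI₂ M e c1) + bit (inI₂ M e c2))
    ≡⟨ faces-arith (faces Mₑ c1) (faces Mₑ c2) (faces M c1) (faces M c2)
                  (bit (inI₂ M e c1)) (bit (inI₂ M e c2)) (b M) (face-change c1) (face-change c2) ⟩
  F M + 3
    ∎)
  where open Unhooking M M∈𝓜 e e-not-bridge
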